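{- For every connected graph $G$ and every non-trivial connected graph $H$, \[\gamma_{r2}(G\circ H)\ge 2\gamma(G).\]
   Context: All graphs are finite and simple; non-trivial means at least two vertices. A $2$-rainbow dominating function of a graph $X$ is a map $f\colon V(X)\to 2^{\{1,2\}}$ such that for every vertex $v$ with $f(v)=\emptyset$ we have $\bigcup_{u\in N(v)} f(u)=\{1,2\}$; its weight is $\sum_v |f(v)|$, and $\gamma_{r2}(X)$ is the minimum weight of such a function. The lexicographic product $G\circ H$ has vertex set $V(G)\times V(H)$, with $(g_1,h_1)$ adjacent to $(g_2,h_2)$ iff $g_1g_2\in E(G)$, or $g_1=g_2$ and $h_1h_2\in E(H)$. $\gamma(G)$ is the domination number of $G$. -}

module Defs where

open import Data.Nat using (ℕ; zero; suc; _+_; _*_; _≤_)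
open import Data.Fin using (Fin; remQuot)
open import Data.Fin.Subset using (Subset; _∈_; ∣_∣)
open import Data.Bool using (Bool; true; false; _∨_)
open import Data.Product using (_×_; _,_; proj₁; proj₂; Σ; ∃)
open import Data.Sum using (_⊎_)
open import Data.Vec using (tabulate; sum)
open import Relation.Binary.PropositionalEquality using (_≡_; _≢_)
open import Relation.Nullary using (¬_)

record Graph (n : ℕ) : Set₁ where
  field
    Adj   : Fin n → Fin n → Set
    irrefl : ∀ u → ¬ Adj u u
    sym   : ∀ {u v} → Adj u v → Adj v u
open Graph public

data Walk {n : ℕ} (G : Graph n) : Fin n → Fin n → Set where
  here : ∀ {u} → Walk G u u
  step : ∀ {u v w} → Adj G u v → Walk G v w → Walk G u w

Connected : ∀ {n} → Graph n → Set
Connected {n} G = ∀ (u v : Fin n) → Walk G u v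

NonTrivial : ∀ {n} → Graph n → Set
NonTrivial {n} _ = 2 ≤ n

lexAdj : ∀ {m n} → Graph m → Graph n → Fin m × Fin n → Fin m × Fin n → Set
lexAdj G H (g₁ , h₁) (g₂ , h₂) = Adj G g₁ g₂ ⊎ (g₁ ≡ g₂ × Adj H h₁ h₂)

_∘ₗ_ : ∀ {m n} → Graph m → Graph n → Graph (m * n)
_∘ₗ_ {m} {n} G H = record
  { Adj = λ x y → lexAdj G H (remQuot n x) (remQuot n y)
  ; irrefl = irr
  ; sym = sy
  }
  where
  irr : ∀ x → ¬ lexAdj G H (remQuot n x) (remQuot n x)
  irr x (Data.Sum.inj₁ a) = irrefl G _ a
  irr x (Data.Sum.inj₂ (_ , a)) = irrefl H _ a
  sy : ∀ {x y} → lexAdj G H (remQuot n x) (remQuot n y) → lexAdj G H (remQuot n y) (remQuot n x)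
  sy (Data.Sum.inj₁ a) = Data.Sum.inj₁ (sym G a)
  sy (Data.Sum.inj₂ (e , a)) = Data.Sum.inj₂ (Relation.Binary.PropositionalEquality.sym e , sym H a)

Dominating : ∀ {n} → Graph n → Subset n → Set
Dominating {n} G D = ∀ v → v ∈ D ⊎ ∃ λ u → u ∈ D × Adj G u v

IsDominationNumber : ∀ {n} → Graph n → ℕ → Set
IsDominationNumber {n} G k =
  (Σ (Subset n) λ D → Dominating G D × ∣ D ∣ ≡ k) ×
  (∀ D → Dominating G D → k ≤ ∣ D ∣)

-- A label f(v) ⊆ {1,2} is a pair of Booleans (1 ∈ f(v) , 2 ∈ f(v)).
Label : Set
Label = Bool × Bool

∣_∣ₗ : Label → ℕ
∣ (a , b) ∣ₗ = val a + val b
  where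
  val : Bool → ℕ
  val true = 1
  val false = 0

Is2RDF : ∀ {n} → Graph n → (Fin n → Label) → Set
Is2RDF {n} G f =
  ∀ v → f v ≡ (false , false) →
    (∃ λ u → Adj G u v × proj₁ (f u) ≡ true) ×
    (∃ λ u → Adj G u v × proj₂ (f u) ≡ true)

weight : ∀ {n} → (Fin n → Label) → ℕ
weight f = sum (tabulate (λ v → ∣ f v ∣ₗ))

IsRainbowDominationNumber : ∀ {n} → Graph n → ℕ → Set
IsRainbowDominationNumber {n} G k =
  (Σ (Fin n → Label) λ f → Is2RDF G f × weight f ≡ k) ×
  (∀ f → Is2RDF G f → k ≤ weight f)

-- Let f be a 2-rainbow dominating function of G ∘ H and put g into D₁ when
-- the fibre {g} × H carries the colour 1 at least once or the colour 2 at
-- least twice (D₂ symmetrically).  If g ∉ D₁, the fibre of g has no 1 and at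
-- most one 2, so as |H| ≥ 2 some (g , h) is labelled ∅; its neighbour labelled
-- 1 lies in a fibre g′ ≠ g, hence g′ ∈ D₁ and g′ is adjacent to g in G.  Thus
-- D₁ and D₂ both dominate G, while each fibre adds at most its own weight to
-- |D₁| + |D₂|, giving 2γ(G) ≤ |D₁| + |D₂| ≤ w(f).
module Submission where

open import Defs hiding (sym)
open import Data.Nat using (ℕ; zero; suc; _+_; _*_; _≤_; z≤n; s≤s)
open import Data.Nat.Properties
  using (≤-refl; ≤-trans; m≤m+n; m≤n+m; +-mono-≤; +-monoˡ-≤; +-identityʳ; +-assoc; module ≤-Reasoning; +-0-commutativeMonoid)
open import Data.Fin using (Fin; combine; remQuot; _↑ˡ_; _↑ʳ_) renaming (zero to fzero; suc to fsuc)
open import Data.Fin.Properties using (remQuot-combine; combine-remQuot)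
open import Data.Fin.Subset using (Subset; _∈_; ∣_∣)
open import Data.Bool using (Bool; true; false)
open import Data.Product using (_×_; _,_; proj₁; proj₂; ∃)
open import Data.Sum using (inj₁; inj₂)
open import Data.Vec as Vec using (tabulate)
open import Data.Vec.Properties using (lookup∘tabulate; lookup⇒[]=)
open import Function using (_∘_)
open import Relation.Binary.PropositionalEquality
open import Relation.Nullary using (contradiction)
open import Algebra.Properties.CommutativeMonoid.Sum +-0-commutativeMonoid
  using (sum; sum-syntax; ∑-distrib-+; sum-cong-≗)

sum-tabulate : ∀ {n} (F : Fin n → ℕ) → Vec.sum (tabulate F) ≡ sum F
sum-tabulate {zero}  F = refl
sum-tabulate {suc n} F = cong (F fzero +_) (sum-tabulate (F ∘ fsuc))

∑-↑ : ∀ n k (F : Fin (n + k) → ℕ) →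
      sum F ≡ ∑[ i < n ] F (i ↑ˡ k) + ∑[ j < k ] F (n ↑ʳ j)
∑-↑ zero    k F = refl
∑-↑ (suc n) k F = trans (cong (F fzero +_) (∑-↑ n k (F ∘ fsuc))) (sym (+-assoc (F fzero) _ _))

∑-combine : ∀ m n (F : Fin (m * n) → ℕ) →
            sum F ≡ ∑[ g < m ] ∑[ h < n ] F (combine g h)
∑-combine zero    n F = refl
∑-combine (suc m) n F =
  trans (∑-↑ n (m * n) F) (cong (∑[ h < n ] F (h ↑ˡ m * n) +_) (∑-combine m n (F ∘ (n ↑ʳ_))))

∑-mono-≤ : ∀ {n} {F G : Fin n → ℕ} → (∀ i → F i ≤ G i) → sum F ≤ sum G
∑-mono-≤ {zero}  F≤G = z≤n
∑-mono-≤ {suc n} F≤G = +-mono-≤ (F≤G fzero) (∑-mono-≤ (F≤G ∘ fsuc))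

term≤∑ : ∀ {n} (F : Fin n → ℕ) i → F i ≤ sum F
term≤∑ F fzero    = m≤m+n (F fzero) _
term≤∑ F (fsuc i) = ≤-trans (term≤∑ (F ∘ fsuc) i) (m≤n+m _ (F fzero))

toℕ : Bool → ℕ
toℕ false = 0
toℕ true  = 1

∣tabulate∣ : ∀ {n} (p : Fin n → Bool) → ∣ tabulate p ∣ ≡ ∑[ i < n ] toℕ (p i)
∣tabulate∣ {zero}  p = refl
∣tabulate∣ {suc n} p with p fzero
... | true  = cong suc (∣tabulate∣ (p ∘ fsuc))
... | false = ∣tabulate∣ (p ∘ fsuc)

true⇒1≤∑ : ∀ {n} (p : Fin n → Bool) {i} → p i ≡ true → 1 ≤ ∑[ j < n ] toℕ (p j)
true⇒1≤∑ {n} p {i} pᵢ≡true = subst (λ b → toℕ b ≤ ∑[ j < n ] toℕ (p j)) pᵢ≡true (term≤∑ (toℕ ∘ p) i)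

∑≡0⇒false : ∀ {n} (p : Fin n → Bool) → ∑[ j < n ] toℕ (p j) ≡ 0 → ∀ i → p i ≡ false
∑≡0⇒false p ∑≡0 i with p i in pᵢ
... | false = refl
... | true  with subst (1 ≤_) ∑≡0 (true⇒1≤∑ p pᵢ)
...   | ()

∑≤1⇒∃false : ∀ {n} (p : Fin n → Bool) → 2 ≤ n → ∑[ j < n ] toℕ (p j) ≤ 1 →
             ∃ λ i → p i ≡ false
∑≤1⇒∃false {suc (suc n)} p _ ∑≤1 with p fzero in p₀ | p (fsuc fzero) in p₁
... | false | _     = fzero , p₀
... | true  | false = fsuc fzero , p₁
... | true  | true  with ∑≤1
...   | s≤s ()
∑≤1⇒∃false {suc zero} p (s≤s ()) _

∘ₗ-adj-combine : ∀ {m n} (G : Graph m) (H : Graph n) {g₁ g₂ h₁ h₂} →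
                 Adj (G ∘ₗ H) (combine g₁ h₁) (combine g₂ h₂) →
                 lexAdj G H (g₁ , h₁) (g₂ , h₂)
∘ₗ-adj-combine G H {g₁} {g₂} {h₁} {h₂} =
  subst₂ (lexAdj G H) (remQuot-combine g₁ h₁) (remQuot-combine g₂ h₂)

∀-combine : ∀ {m} n {P : Fin (m * n) → Set} → (∀ g h → P (combine g h)) → ∀ v → P v
∀-combine {m} n {P} P-combine v =
  subst P (combine-remQuot {m} n v) (P-combine (proj₁ (remQuot {m} n v)) (proj₂ (remQuot {m} n v)))

-- chosen a b: the fibre has a vertex of its own colour (a ≥ 1) or two of
-- the other colour (b ≥ 2).
chosen : ℕ → ℕ → Bool
chosen zero    zero          = false
chosen zero    (suc zero)    = false
chosen zero    (suc (suc _)) = true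
chosen (suc _) _             = true

chosen-cost : ∀ a b → toℕ (chosen a b) + toℕ (chosen b a) ≤ a + b
chosen-cost zero          zero          = z≤n
chosen-cost zero          (suc zero)    = ≤-refl
chosen-cost zero          (suc (suc b)) = s≤s (s≤s z≤n)
chosen-cost (suc zero)    zero          = ≤-refl
chosen-cost (suc (suc a)) zero          = s≤s (s≤s z≤n)
chosen-cost (suc a)       (suc b)       = s≤s (≤-trans (s≤s z≤n) (m≤n+m (suc b) a))

chosen-pos : ∀ {a} b → 1 ≤ a → chosen a b ≡ true
chosen-pos b (s≤s _) = refl

unchosen : ∀ a b → chosen a b ≡ false → a ≡ 0 × b ≤ 1
unchosen zero zero       _ = refl , z≤n
unchosen zero (suc zero) _ = refl , ≤-refl

∣_∣ₗ-split : ∀ x → ∣ x ∣ₗ ≡ toℕ (proj₁ x) + toℕ (proj₂ x)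
∣ true  , true  ∣ₗ-split = refl
∣ true  , false ∣ₗ-split = refl
∣ false , true  ∣ₗ-split = refl
∣ false , false ∣ₗ-split = refl

module Fibres (m n : ℕ) where

  fibreCount : (Fin (m * n) → Bool) → Fin m → ℕ
  fibreCount c g = ∑[ h < n ] toℕ (c (combine g h))

  chosenSet : (c c′ : Fin (m * n) → Bool) → Subset m
  chosenSet c c′ = tabulate λ g → chosen (fibreCount c g) (fibreCount c′ g)

  ∈chosenSet : ∀ c c′ {g} → chosen (fibreCount c g) (fibreCount c′ g) ≡ true → g ∈ chosenSet c c′
  ∈chosenSet c c′ {g} chosen≡true = lookup⇒[]= g _ (trans (lookup∘tabulate _ g) chosen≡true)

  chosenSet-dominating :
    (G : Graph m) (H : Graph n) → 2 ≤ n → (c c′ : Fin (m * n) → Bool) →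
    (∀ v → c v ≡ false → c′ v ≡ false → ∃ λ u → Adj (G ∘ₗ H) u v × c u ≡ true) →
    Dominating G (chosenSet c c′)
  chosenSet-dominating G H 2≤n c c′ covered g
    with chosen (fibreCount c g) (fibreCount c′ g) in g-chosen
  ... | true  = inj₁ (∈chosenSet c c′ g-chosen)
  ... | false with unchosen _ _ g-chosen
  ...   | noC , fewC′ with ∑≤1⇒∃false (c′ ∘ combine g) 2≤n fewC′
  ...     | h , c′≡false with covered (combine g h) (∑≡0⇒false (c ∘ combine g) noC h) c′≡false
  ...       | u , u~gh , cu = inj₂ (∀-combine {m} n {P} neighbour u u~gh cu)
    where
    P : Fin (m * n) → Set
    P u = Adj (G ∘ₗ H) u (combine g h) → c u ≡ true → ∃ λ g′ → g′ ∈ chosenSet c c′ × Adj G g′ g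

    fromLexAdj : ∀ {g′ h′} → lexAdj G H (g′ , h′) (g , h) → c (combine g′ h′) ≡ true →
                 ∃ λ g″ → g″ ∈ chosenSet c c′ × Adj G g″ g
    fromLexAdj {g′} (inj₁ g′~g) cg′h′ =
      g′ , ∈chosenSet c c′ (chosen-pos _ (true⇒1≤∑ (c ∘ combine g′) cg′h′)) , g′~g
    fromLexAdj {h′ = h′} (inj₂ (refl , _)) cgh′ =
      contradiction (trans (sym cgh′) (∑≡0⇒false (c ∘ combine g) noC h′)) λ ()

    neighbour : ∀ g′ h′ → P (combine g′ h′)
    neighbour g′ h′ adj = fromLexAdj (∘ₗ-adj-combine G H adj)

  weight≡∑fibreCount : (f : Fin (m * n) → Label) →
    weight f ≡ ∑[ g < m ] (fibreCount (proj₁ ∘ f) g + fibreCount (proj₂ ∘ f) g)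
  weight≡∑fibreCount f = begin
    weight f                                   ≡⟨ sum-tabulate (λ v → ∣ f v ∣ₗ) ⟩
    ∑[ v < m * n ] ∣ f v ∣ₗ                     ≡⟨ ∑-combine m n (λ v → ∣ f v ∣ₗ) ⟩
    ∑[ g < m ] ∑[ h < n ] ∣ f (combine g h) ∣ₗ  ≡⟨ sum-cong-≗ split ⟩
    ∑[ g < m ] (fibreCount (proj₁ ∘ f) g + fibreCount (proj₂ ∘ f) g) ∎
    where
    open ≡-Reasoning
    split : ∀ g → ∑[ h < n ] ∣ f (combine g h) ∣ₗ ≡ fibreCount (proj₁ ∘ f) g + fibreCount (proj₂ ∘ f) g
    split g = trans (sum-cong-≗ (λ h → ∣ f (combine g h) ∣ₗ-split))
                    (∑-distrib-+ (toℕ ∘ proj₁ ∘ f ∘ combine g) (toℕ ∘ proj₂ ∘ f ∘ combine g))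

  ∣chosenSets∣≤weight : (f : Fin (m * n) → Label) →
    ∣ chosenSet (proj₁ ∘ f) (proj₂ ∘ f) ∣ + ∣ chosenSet (proj₂ ∘ f) (proj₁ ∘ f) ∣ ≤ weight f
  ∣chosenSets∣≤weight f = begin
    ∣ chosenSet c₁ c₂ ∣ + ∣ chosenSet c₂ c₁ ∣
      ≡⟨ cong₂ _+_ (∣tabulate∣ (λ g → chosen (A g) (B g))) (∣tabulate∣ (λ g → chosen (B g) (A g))) ⟩
    ∑[ g < m ] toℕ (chosen (A g) (B g)) + ∑[ g < m ] toℕ (chosen (B g) (A g))
      ≡⟨ sym (∑-distrib-+ (λ g → toℕ (chosen (A g) (B g))) (λ g → toℕ (chosen (B g) (A g)))) ⟩
    ∑[ g < m ] (toℕ (chosen (A g) (B g)) + toℕ (chosen (B g) (A g)))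
      ≤⟨ ∑-mono-≤ (λ g → chosen-cost (A g) (B g)) ⟩
    ∑[ g < m ] (A g + B g)
      ≡⟨ sym (weight≡∑fibreCount f) ⟩
    weight f ∎
    where
    open ≤-Reasoning
    c₁ c₂ : Fin (m * n) → Bool
    c₁ = proj₁ ∘ f
    c₂ = proj₂ ∘ f
    A B : Fin m → ℕ
    A = fibreCount c₁
    B = fibreCount c₂

theorem8 : ∀ {m n} (G : Graph m) (H : Graph n) →
    Connected G → Connected H → NonTrivial H →
    ∀ (γ γr2 : ℕ) → IsDominationNumber G γ →
    IsRainbowDominationNumber (G ∘ₗ H) γr2 →
    2 * γ ≤ γr2
theorem8 {m} {n} G H _ _ 2≤n γ γr2 (_ , γ-min) ((f , f-rdf , weight≡γr2) , _) = begin
  γ + (γ + 0)           ≤⟨ +-mono-≤ (γ-min D₁ D₁-dominating) (+-monoˡ-≤ 0 (γ-min D₂ D₂-dominating)) ⟩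
  ∣ D₁ ∣ + (∣ D₂ ∣ + 0) ≡⟨ cong (∣ D₁ ∣ +_) (+-identityʳ _) ⟩
  ∣ D₁ ∣ + ∣ D₂ ∣       ≤⟨ ∣chosenSets∣≤weight f ⟩
  weight f              ≡⟨ weight≡γr2 ⟩
  γr2                   ∎
  where
  open ≤-Reasoning
  open Fibres m n
  D₁ D₂ : Subset m
  D₁ = chosenSet (proj₁ ∘ f) (proj₂ ∘ f)
  D₂ = chosenSet (proj₂ ∘ f) (proj₁ ∘ f)
  unlabelled : ∀ {x : Label} → proj₁ x ≡ false → proj₂ x ≡ false → x ≡ (false , false)
  unlabelled refl refl = refl
  D₁-dominating : Dominating G D₁
  D₁-dominating = chosenSet-dominating G H 2≤n _ _ λ v c₁ c₂ → proj₁ (f-rdf v (unlabelled c₁ c₂))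
  D₂-dominating : Dominating G D₂
  D₂-dominating = chosenSet-dominating G H 2≤n _ _ λ v c₂ c₁ → proj₂ (f-rdf v (unlabelled c₁ c₂))
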